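{- Let $s$ be an SPS over $\mathcal P$. Then the map $\lfloor\!\lfloor\cdot\rfloor\!\rfloor$ is a bijection between the schema interpretations satisfying $s$ and the LTL interpretations (over $\mathcal P\cup\{a,b\}$) that are models of $\lfloor s\rfloor$; its inverse is $\lfloor\!\lfloor\cdot\rfloor\!\rfloor^{ -1}$.
   Context: Schemata and SPS: propositional interpretations are functions $\sigma:\mathcal P\times\mathbb N\to\{\mathrm{true},\mathrm{false}\}$ (identified with the set of true pairs); schemata $s::=\top\mid p_e\mid\neg s\mid s\wedge s\mid\bigwedge_{\mathsf i=0}^{\mathsf n-1}s$ with Presburger arithmetic indices and single parameter $\mathsf n$; instance $\langle s\rangle_m$: $\langle p_e\rangle_m=p_{e[m/\mathsf n]}$, commutes with $\neg,\wedge$, $\langle\bigwedge_{\mathsf i=0}^{\mathsf n-1}s\rangle_m=\top$ if $m=0$ and $\bigwedge_{j=0}^{m-1}\langle s[j/\mathsf i]\rangle_m$ otherwise; a schema interpretation $(\sigma,m)$ satisfies $s$ iff $\sigma\models\langle s\rangle_m$ ($\sigma\models p_k$ iff $(p,k)\in\sigma$). An SPS is a schema with no nested iterations, indices outside iterations of the form $k$ or $\mathsf n+k$, and indices inside an iteration $\bigwedge_{\mathsf i=0}^{\mathsf n-1}$ of the form $\mathsf i+k$ ($k\in\mathbb N$). LTL: formulae $\phi::=\top\mid p\mid\neg\phi\mid\phi\wedge\phi\mid X\phi\mid\phi U\phi$; an LTL interpretation is a propositional interpretation $\sigma$; $\sigma,t\models p$ iff $(p,t)\in\sigma$; Boolean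 cases as usual; $\sigma,t\models X\phi$ iff $\sigma,t+1\models\phi$; $\sigma,t\models\phi_1U\phi_2$ iff there is $k\in\mathbb N$ with $\sigma,t+k\models\phi_2$ and $\sigma,t+i\models\phi_1$ for all $i<k$. $F\phi:=\top U\phi$, $G\phi:=\neg F\neg\phi$, $X^k$ is $k$-fold $X$; $\sigma\models\phi$ means $\sigma,0\models\phi$. Translation: let $a$ ("$t<\mathsf n$") and $b$ ("$t=\mathsf n$") be fresh propositional variables. Define $\lfloor\top\rfloor_{\mathrm{prop}}=\top$, $\lfloor p_k\rfloor_{\mathrm{prop}}=X^kp$, $\lfloor p_{\mathsf n+k}\rfloor_{\mathrm{prop}}=G(b\Rightarrow X^kp)$, $\lfloor p_{\mathsf i+k}\rfloor_{\mathrm{prop}}=X^kp$ (for a bound variable $\mathsf i\neq\mathsf n$), $\lfloor\neg s\rfloor_{\mathrm{prop}}=\neg\lfloor s\rfloor_{\mathrm{prop}}$, $\lfloor s_1\wedge s_2\rfloor_{\mathrm{prop}}=\lfloor s_1\rfloor_{\mathrm{prop}}\wedge\lfloor s_2\rfloor_{\mathrm{prop}}$, $\lfloor\bigwedge_{\mathsf i=0}^{\mathsf n-1}s\rfloor_{\mathrm{prop}}=G(a\Rightarrow\lfloor s\rfloor_{\mathrm{prop}})$. Then $\lfloor s\rfloor=\lfloor s\rfloor_{\mathrm{prop}}\wedge(a\,U\,G\neg a)\wedge G((a\wedge\neg Xa)\Leftrightarrow Xb)\wedge(\neg a\Leftrightarrow b)$. Interpretation maps: for a schema interpretation $(\sigma,n)$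 over $\mathcal P$, $\lfloor\!\lfloor(\sigma,n)\rfloor\!\rfloor$ is the LTL interpretation over $\mathcal P\cup\{a,b\}$ that agrees with $\sigma$ on $\mathcal P$, in which $(a,t)$ is true iff $t<n$, and $(b,t)$ is true iff $t=n$. For an LTL interpretation $\sigma$ over $\mathcal P\cup\{a,b\}$ that is an initial segment of some length $n$ for $a$ (i.e. $(a,t)\in\sigma$ iff $t<n$), $\lfloor\!\lfloor\sigma\rfloor\!\rfloor^{ -1}=(\tau,n)$ where $\tau$ is the restriction of $\sigma$ to $\mathcal P$. -}

module Defs where

open import Data.Nat using (ℕ; zero; suc; _+_; _<_; _<ᵇ_; _≡ᵇ_)
open import Data.Bool using (Bool; true; false)
open import Data.Product using (Σ; _×_; _,_)
open import Data.Unit using (⊤)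
open import Relation.Nullary using (¬_)
open import Relation.Binary.PropositionalEquality using (_≡_)

-- Propositional interpretations: σ : 𝒫 × ℕ → {true,false}
-- ((p,k) ∈ σ  iff  σ p k ≡ true)

Interp : Set → Set
Interp P = P → ℕ → Bool

_≈ᴵ_ : {P : Set} → Interp P → Interp P → Set
σ ≈ᴵ τ = ∀ p t → σ p t ≡ τ p t

data PForm (P : Set) : Set where
  ⊤ᵖ   : PForm P
  atᵖ  : P → ℕ → PForm P
  ¬ᵖ_  : PForm P → PForm P
  _∧ᵖ_ : PForm P → PForm P → PForm P

_⊨ᵖ_ : {P : Set} → Interp P → PForm P → Set
σ ⊨ᵖ ⊤ᵖ       = ⊤
σ ⊨ᵖ atᵖ p k  = σ p k ≡ true
σ ⊨ᵖ (¬ᵖ f)   = ¬ (σ ⊨ᵖ f)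
σ ⊨ᵖ (f ∧ᵖ g) = (σ ⊨ᵖ f) × (σ ⊨ᵖ g)

conj : {P : Set} → (ℕ → PForm P) → ℕ → PForm P
conj f zero    = f zero
conj f (suc m) = conj f m ∧ᵖ f (suc m)

-- SPS (single parameter n, no nested iterations).
-- Inner: bodies of an iteration ⋀_{i=0}^{n-1}, indices of the form i+k.
-- SPS: indices outside iterations of the form k or n+k.

data Inner (P : Set) : Set where
  ⊤ⁱ   : Inner P
  atⁱ  : P → ℕ → Inner P
  ¬ⁱ_  : Inner P → Inner P
  _∧ⁱ_ : Inner P → Inner P → Inner P

data SPS (P : Set) : Set where
  ⊤ˢ   : SPS P
  atˢ  : P → ℕ → SPS P
  atnˢ : P → ℕ → SPS P
  ¬ˢ_  : SPS P → SPS P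
  _∧ˢ_ : SPS P → SPS P → SPS P
  bigˢ : Inner P → SPS P

instInner : {P : Set} → ℕ → Inner P → PForm P
instInner j ⊤ⁱ        = ⊤ᵖ
instInner j (atⁱ p k) = atᵖ p (j + k)
instInner j (¬ⁱ s)    = ¬ᵖ instInner j s
instInner j (s ∧ⁱ t)  = instInner j s ∧ᵖ instInner j t

inst : {P : Set} → ℕ → SPS P → PForm P
inst m ⊤ˢ          = ⊤ᵖ
inst m (atˢ p k)   = atᵖ p k
inst m (atnˢ p k)  = atᵖ p (m + k)
inst m (¬ˢ s)      = ¬ᵖ inst m s
inst m (s ∧ˢ t)    = inst m s ∧ᵖ inst m t
inst zero (bigˢ s)    = ⊤ᵖ
inst (suc m) (bigˢ s) = conj (λ j → instInner j s) m

SInterp : Set → Set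
SInterp P = Interp P × ℕ

_⊨ˢ_ : {P : Set} → SInterp P → SPS P → Set
(σ , m) ⊨ˢ s = σ ⊨ᵖ inst m s

_≈ˢ_ : {P : Set} → SInterp P → SInterp P → Set
(σ , m) ≈ˢ (τ , k) = (m ≡ k) × (σ ≈ᴵ τ)

data LTL (V : Set) : Set where
  ⊤ˡ   : LTL V
  atˡ  : V → LTL V
  ¬ˡ_  : LTL V → LTL V
  _∧ˡ_ : LTL V → LTL V → LTL V
  Xˡ   : LTL V → LTL V
  _Uˡ_ : LTL V → LTL V → LTL V

infix 4 _∣_⊨ˡ_ _⊨ˡ_ _⊨ᵖ_ _⊨ˢ_ _≈ˢ_ _≈ᴵ_
infixr 6 _∧ˡ_ _∧ᵖ_ _∧ˢ_ _∧ⁱ_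
infixr 5 _⇒ˡ_ _⇔ˡ_
infix 7 _Uˡ_
infix 8 ¬ˡ_ ¬ᵖ_ ¬ˢ_ ¬ⁱ_

_∣_⊨ˡ_ : {V : Set} → Interp V → ℕ → LTL V → Set
σ ∣ t ⊨ˡ ⊤ˡ       = ⊤
σ ∣ t ⊨ˡ atˡ p    = σ p t ≡ true
σ ∣ t ⊨ˡ (¬ˡ φ)   = ¬ (σ ∣ t ⊨ˡ φ)
σ ∣ t ⊨ˡ (φ ∧ˡ ψ) = (σ ∣ t ⊨ˡ φ) × (σ ∣ t ⊨ˡ ψ)
σ ∣ t ⊨ˡ Xˡ φ     = σ ∣ suc t ⊨ˡ φ
σ ∣ t ⊨ˡ (φ Uˡ ψ) = Σ ℕ λ k → (σ ∣ t + k ⊨ˡ ψ) × (∀ i → i < k → σ ∣ t + i ⊨ˡ φ)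

_⊨ˡ_ : {V : Set} → Interp V → LTL V → Set
σ ⊨ˡ φ = σ ∣ 0 ⊨ˡ φ

Fˡ Gˡ : {V : Set} → LTL V → LTL V
Fˡ φ = ⊤ˡ Uˡ φ
Gˡ φ = ¬ˡ Fˡ (¬ˡ φ)

_⇒ˡ_ _⇔ˡ_ : {V : Set} → LTL V → LTL V → LTL V
φ ⇒ˡ ψ = ¬ˡ (φ ∧ˡ ¬ˡ ψ)
φ ⇔ˡ ψ = (φ ⇒ˡ ψ) ∧ˡ (ψ ⇒ˡ φ)

Xⁿ : {V : Set} → ℕ → LTL V → LTL V
Xⁿ zero φ    = φ
Xⁿ (suc k) φ = Xˡ (Xⁿ k φ)

data Var (P : Set) : Set where
  var : P → Var P
  a   : Var P          -- "t < n"
  b   : Var P          -- "t = n"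

⌊_⌋ⁱ : {P : Set} → Inner P → LTL (Var P)
⌊ ⊤ⁱ ⌋ⁱ      = ⊤ˡ
⌊ atⁱ p k ⌋ⁱ = Xⁿ k (atˡ (var p))
⌊ ¬ⁱ s ⌋ⁱ    = ¬ˡ ⌊ s ⌋ⁱ
⌊ s ∧ⁱ t ⌋ⁱ  = ⌊ s ⌋ⁱ ∧ˡ ⌊ t ⌋ⁱ

⌊_⌋ᵖʳᵒᵖ : {P : Set} → SPS P → LTL (Var P)
⌊ ⊤ˢ ⌋ᵖʳᵒᵖ       = ⊤ˡ
⌊ atˢ p k ⌋ᵖʳᵒᵖ  = Xⁿ k (atˡ (var p))
⌊ atnˢ p k ⌋ᵖʳᵒᵖ = Gˡ (atˡ b ⇒ˡ Xⁿ k (atˡ (var p)))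
⌊ ¬ˢ s ⌋ᵖʳᵒᵖ     = ¬ˡ ⌊ s ⌋ᵖʳᵒᵖ
⌊ s ∧ˢ t ⌋ᵖʳᵒᵖ   = ⌊ s ⌋ᵖʳᵒᵖ ∧ˡ ⌊ t ⌋ᵖʳᵒᵖ
⌊ bigˢ s ⌋ᵖʳᵒᵖ   = Gˡ (atˡ a ⇒ˡ ⌊ s ⌋ⁱ)

⌊_⌋ : {P : Set} → SPS P → LTL (Var P)
⌊ s ⌋ = ⌊ s ⌋ᵖʳᵒᵖ
     ∧ˡ ((atˡ a Uˡ Gˡ (¬ˡ atˡ a))
     ∧ˡ (Gˡ ((atˡ a ∧ˡ ¬ˡ Xˡ (atˡ a)) ⇔ˡ Xˡ (atˡ b))
     ∧ˡ ((¬ˡ atˡ a) ⇔ˡ atˡ b)))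

toLTL : {P : Set} → SInterp P → Interp (Var P)
toLTL (σ , n) (var p) t = σ p t
toLTL (σ , n) a t       = t <ᵇ n
toLTL (σ , n) b t       = t ≡ᵇ n

IsInitialSegment : {P : Set} → Interp (Var P) → ℕ → Set
IsInitialSegment σ n = ∀ t → (σ a t ≡ true → t < n) × (t < n → σ a t ≡ true)

fromLTL : {P : Set} (σ : Interp (Var P)) (n : ℕ) → IsInitialSegment σ n → SInterp P
fromLTL σ n _ = ((λ p t → σ (var p) t) , n)

-- The last three conjuncts of ⌊ s ⌋ (parameterSpec below) hold in τ exactly when, for
-- some n, a holds on the initial segment [0, n) and b holds exactly at n; the images
-- ⌊⌊(σ , n)⌋⌋ are such interpretations. Over such a τ, induction on s shows that
-- τ ⊨ ⌊ s ⌋ᵖʳᵒᵖ iff (τ restricted to 𝒫 , n) ⊨ s: G (a ⇒ ·) ranges over the instances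
-- j < n of an iteration, and G (b ⇒ Xᵏ p) reads p at n + k. Both maps keep n and the
-- 𝒫-part, so they are mutually inverse.
module Submission where

open import Defs
open import Data.Bool using (Bool; true; false)
open import Data.Bool.Properties using (T-≡) renaming (_≟_ to _≟ᵇ_)
open import Data.Nat using (ℕ; zero; suc; _+_; _∸_; _<_; _<ᵇ_; _≡ᵇ_; z<s; s<s)
open import Data.Nat.Properties
  using (<ᵇ⇒<; <⇒<ᵇ; ≡ᵇ⇒≡; ≡⇒≡ᵇ; _<?_; ≮⇒≥; ≤-antisym; ≤-refl; n≮0; n≮n; m+n≮m;
         m<n⇒m<1+n; m<1+n⇒m<n∨m≡n; m+[n∸m]≡n; +-identityʳ; +-suc)
open import Data.Product using (Σ; _×_; _,_; proj₂)
open import Data.Product.Function.NonDependent.Propositional using (_×-⇔_)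
open import Data.Sum using ([_,_]′)
open import Data.Unit using (tt)
open import Function.Bundles using (_⇔_; mk⇔; Equivalence)
open import Function.Properties.Equivalence using ()
  renaming (refl to ⇔-refl; sym to ⇔-sym; trans to ⇔-trans)
open import Function.Related.Propositional using (module EquationalReasoning; equivalence)
open import Function.Related.TypeIsomorphisms using (¬-cong-⇔)
open import Relation.Nullary using (¬_; Dec; yes; ¬?; _×-dec_)
open import Relation.Nullary.Decidable using (decidable-stable)
open import Relation.Nullary.Negation using (Stable; contradiction)
open import Relation.Binary.PropositionalEquality using (_≡_; refl; sym; subst)

open Equivalence using (to; from)
open EquationalReasoning {k = equivalence}

private
  variable
    P V : Set
    σ τ : Interp V
    φ ψ : LTL V
    v : V
    m n t : ℕ

<ᵇ≡true⇔< : ((m <ᵇ n) ≡ true) ⇔ m < n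
<ᵇ≡true⇔< {m} {n} = ⇔-trans (⇔-sym T-≡) (mk⇔ (<ᵇ⇒< m n) <⇒<ᵇ)

≡ᵇ≡true⇔≡ : ((m ≡ᵇ n) ≡ true) ⇔ m ≡ n
≡ᵇ≡true⇔≡ {m} {n} = ⇔-trans (⇔-sym T-≡) (mk⇔ (≡ᵇ⇒≡ m n) (≡⇒≡ᵇ m n))

≡true⇔⇒≡ : {x y : Bool} → (x ≡ true ⇔ y ≡ true) → x ≡ y
≡true⇔⇒≡ {true}          x⇔y = sym (to x⇔y refl)
≡true⇔⇒≡ {false} {false} _   = refl
≡true⇔⇒≡ {false} {true}  x⇔y = contradiction (from x⇔y refl) λ ()

0≮n⇔0≡n : (¬ 0 < n) ⇔ 0 ≡ n
0≮n⇔0≡n {zero}  = mk⇔ (λ _ → refl) (λ _ → n≮0)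
0≮n⇔0≡n {suc n} = mk⇔ (λ 0≮n → contradiction z<s 0≮n) λ ()

m<n×1+m≮n⇔1+m≡n : (m < n × ¬ suc m < n) ⇔ suc m ≡ n
m<n×1+m≮n⇔1+m≡n {m} = mk⇔ (λ (m<n , 1+m≮n) → ≤-antisym m<n (≮⇒≥ 1+m≮n))
                          λ { refl → ≤-refl , n≮n (suc m) }

∀<1+m⇔ : {Q : ℕ → Set} → (∀ j → j < suc m → Q j) ⇔ ((∀ j → j < m → Q j) × Q m)
∀<1+m⇔ = mk⇔ (λ all → (λ j j<m → all j (m<n⇒m<1+n j<m)) , all _ ≤-refl)
              (λ (below , top) j j<1+m →
                 [ below j , (λ { refl → top }) ]′ (m<1+n⇒m<n∨m≡n j<1+m))

-- U-free formulas. Their satisfaction is decidable, which makes the classical reading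
-- of ⇒ˡ, ⇔ˡ and Gˡ = ¬F¬ available constructively.
data Local {V : Set} : LTL V → Set where
  ⊤ˡ   : Local ⊤ˡ
  atˡ  : (v : V) → Local (atˡ v)
  ¬ˡ_  : {φ : LTL V} → Local φ → Local (¬ˡ φ)
  _∧ˡ_ : {φ ψ : LTL V} → Local φ → Local ψ → Local (φ ∧ˡ ψ)
  Xˡ   : {φ : LTL V} → Local φ → Local (Xˡ φ)

⊨ˡ-dec : Local φ → (σ : Interp V) (t : ℕ) → Dec (σ ∣ t ⊨ˡ φ)
⊨ˡ-dec ⊤ˡ        σ t = yes tt
⊨ˡ-dec (atˡ v)   σ t = σ v t ≟ᵇ true
⊨ˡ-dec (¬ˡ l)    σ t = ¬? (⊨ˡ-dec l σ t)
⊨ˡ-dec (l ∧ˡ l′) σ t = ⊨ˡ-dec l σ t ×-dec ⊨ˡ-dec l′ σ t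
⊨ˡ-dec (Xˡ l)    σ t = ⊨ˡ-dec l σ (suc t)

⊨ˡ-stable : Local φ → Stable (σ ∣ t ⊨ˡ φ)
⊨ˡ-stable l = decidable-stable (⊨ˡ-dec l _ _)

⇒ˡ-local : Local φ → Local ψ → Local (φ ⇒ˡ ψ)
⇒ˡ-local l l′ = ¬ˡ (l ∧ˡ ¬ˡ l′)

⇔ˡ-local : Local φ → Local ψ → Local (φ ⇔ˡ ψ)
⇔ˡ-local l l′ = ⇒ˡ-local l l′ ∧ˡ ⇒ˡ-local l′ l

Xⁿ-local : ∀ m → Local φ → Local (Xⁿ m φ)
Xⁿ-local zero    l = l
Xⁿ-local (suc m) l = Xˡ (Xⁿ-local m l)

⇔ˡ-intro : (σ ∣ t ⊨ˡ φ) ⇔ (σ ∣ t ⊨ˡ ψ) → σ ∣ t ⊨ˡ φ ⇔ˡ ψ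
⇔ˡ-intro x⇔y = (λ (x , ¬y) → ¬y (to x⇔y x)) , (λ (y , ¬x) → ¬x (from x⇔y y))

⇔ˡ-elim : Local φ → Local ψ → σ ∣ t ⊨ˡ φ ⇔ˡ ψ → (σ ∣ t ⊨ˡ φ) ⇔ (σ ∣ t ⊨ˡ ψ)
⇔ˡ-elim l l′ (x⇒y , y⇒x) = mk⇔ (λ x → ⊨ˡ-stable l′ λ ¬y → x⇒y (x , ¬y))
                                (λ y → ⊨ˡ-stable l λ ¬x → y⇒x (y , ¬x))

G-intro : ∀ (σ : Interp V) t φ → (∀ j → σ ∣ t + j ⊨ˡ φ) → σ ∣ t ⊨ˡ Gˡ φ
G-intro _ _ _ always (j , ¬φ , _) = ¬φ (always j)

G-elim : Local φ → σ ⊨ˡ Gˡ φ → ∀ j → σ ∣ j ⊨ˡ φ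
G-elim l g j = ⊨ˡ-stable l λ ¬φ → g (j , ¬φ , λ _ _ → tt)

Xⁿ-⊨ : ∀ m → (σ ∣ t ⊨ˡ Xⁿ m φ) ⇔ (σ ∣ t + m ⊨ˡ φ)
Xⁿ-⊨ {t = t} zero    rewrite +-identityʳ t = ⇔-refl
Xⁿ-⊨ {t = t} (suc m) rewrite +-suc t m     = Xⁿ-⊨ {t = suc t} m

U-G¬-segment : σ ⊨ˡ atˡ v Uˡ Gˡ (¬ˡ atˡ v) → Σ ℕ λ n → ∀ t → σ v t ≡ true ⇔ t < n
U-G¬-segment {σ = σ} {v = v} (n , never , before) = n , λ t → mk⇔ (after t) (before t)
  where
  after : ∀ t → σ v t ≡ true → t < n
  after t vt = decidable-stable (t <? n) λ t≮n →
    let vt′ = subst (λ u → σ v u ≡ true) (sym (m+[n∸m]≡n (≮⇒≥ t≮n))) vt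
    in never (t ∸ n , (λ ¬vt′ → ¬vt′ vt′) , λ _ _ → tt)

G-⇒-segment : (∀ t → σ v t ≡ true ⇔ t < n) → Local φ →
              (σ ⊨ˡ Gˡ (atˡ v ⇒ˡ φ)) ⇔ (∀ j → j < n → σ ∣ j ⊨ˡ φ)
G-⇒-segment {σ = σ} {v = v} {φ = φ} v⇔ l = mk⇔
  (λ g j j<n → ⊨ˡ-stable l λ ¬φ → g (j , (λ v⇒φ → v⇒φ (from (v⇔ j) j<n , ¬φ)) , λ _ _ → tt))
  (λ all → G-intro σ 0 (atˡ v ⇒ˡ φ) λ j (vj , ¬φ) → ¬φ (all j (to (v⇔ j) vj)))

G-⇒-point : (∀ t → σ v t ≡ true ⇔ t ≡ n) → Local φ →
            (σ ⊨ˡ Gˡ (atˡ v ⇒ˡ φ)) ⇔ (σ ∣ n ⊨ˡ φ)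
G-⇒-point {σ = σ} {v = v} {n = n} {φ = φ} v⇔ l = mk⇔
  (λ g → ⊨ˡ-stable l λ ¬φ → g (n , (λ v⇒φ → v⇒φ (from (v⇔ n) refl , ¬φ)) , λ _ _ → tt))
  (λ φn → G-intro σ 0 (atˡ v ⇒ˡ φ) λ j (vj , ¬φ) →
             ¬φ (subst (σ ∣_⊨ˡ φ) (sym (to (v⇔ j) vj)) φn))

conj-⊨ : (f : ℕ → PForm P) (m : ℕ) → (σ ⊨ᵖ conj f m) ⇔ (∀ j → j < suc m → σ ⊨ᵖ f j)
conj-⊨ f zero    = mk⇔ (λ { f0 zero _ → f0 ; f0 (suc j) (s<s ()) }) (λ all → all 0 z<s)
conj-⊨ f (suc m) = ⇔-trans (conj-⊨ f m ×-⇔ ⇔-refl) (⇔-sym ∀<1+m⇔)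

bigˢ-⊨ : (s : Inner P) → (σ ⊨ᵖ inst n (bigˢ s)) ⇔ (∀ j → j < n → σ ⊨ᵖ instInner j s)
bigˢ-⊨ {n = zero}  s = mk⇔ (λ _ _ ()) (λ _ → tt)
bigˢ-⊨ {n = suc m} s = conj-⊨ (λ j → instInner j s) m

restrict : Interp (Var P) → Interp P
restrict τ p = τ (var p)

⌊⌋ⁱ-local : (s : Inner P) → Local ⌊ s ⌋ⁱ
⌊⌋ⁱ-local ⊤ⁱ        = ⊤ˡ
⌊⌋ⁱ-local (atⁱ p k) = Xⁿ-local k (atˡ (var p))
⌊⌋ⁱ-local (¬ⁱ s)    = ¬ˡ ⌊⌋ⁱ-local s
⌊⌋ⁱ-local (s ∧ⁱ s′) = ⌊⌋ⁱ-local s ∧ˡ ⌊⌋ⁱ-local s′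

⌊⌋ⁱ-correct : (τ : Interp (Var P)) (j : ℕ) (s : Inner P) →
              (τ ∣ j ⊨ˡ ⌊ s ⌋ⁱ) ⇔ (restrict τ ⊨ᵖ instInner j s)
⌊⌋ⁱ-correct τ j ⊤ⁱ        = ⇔-refl
⌊⌋ⁱ-correct τ j (atⁱ p k) = Xⁿ-⊨ k
⌊⌋ⁱ-correct τ j (¬ⁱ s)    = ¬-cong-⇔ (⌊⌋ⁱ-correct τ j s)
⌊⌋ⁱ-correct τ j (s ∧ⁱ s′) = ⌊⌋ⁱ-correct τ j s ×-⇔ ⌊⌋ⁱ-correct τ j s′

record EncodesParameter (τ : Interp (Var P)) (n : ℕ) : Set where
  constructor _,_
  field
    a⇔< : ∀ t → τ a t ≡ true ⇔ t < n
    b⇔≡ : ∀ t → τ b t ≡ true ⇔ t ≡ n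

⌊⌋ᵖʳᵒᵖ-correct : EncodesParameter τ n → (s : SPS P) →
                 (τ ⊨ˡ ⌊ s ⌋ᵖʳᵒᵖ) ⇔ ((restrict τ , n) ⊨ˢ s)
⌊⌋ᵖʳᵒᵖ-correct enc ⊤ˢ = ⇔-refl
⌊⌋ᵖʳᵒᵖ-correct enc (atˢ p k) = Xⁿ-⊨ k
⌊⌋ᵖʳᵒᵖ-correct {τ = τ} (_ , b⇔) (atnˢ p k) =
  ⇔-trans (G-⇒-point {σ = τ} {v = b} b⇔ (Xⁿ-local k (atˡ (var p)))) (Xⁿ-⊨ k)
⌊⌋ᵖʳᵒᵖ-correct enc (¬ˢ s) = ¬-cong-⇔ (⌊⌋ᵖʳᵒᵖ-correct enc s)
⌊⌋ᵖʳᵒᵖ-correct enc (s ∧ˢ s′) = ⌊⌋ᵖʳᵒᵖ-correct enc s ×-⇔ ⌊⌋ᵖʳᵒᵖ-correct enc s′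
⌊⌋ᵖʳᵒᵖ-correct {τ = τ} (a⇔ , _) (bigˢ s) =
  ⇔-trans (G-⇒-segment {σ = τ} {v = a} a⇔ (⌊⌋ⁱ-local s))
    (⇔-trans (mk⇔ (λ all j j<n → to (⌊⌋ⁱ-correct τ j s) (all j j<n))
                  (λ all j j<n → from (⌊⌋ⁱ-correct τ j s) (all j j<n)))
             (⇔-sym (bigˢ-⊨ s)))

lastA nextB aIsSegment bAfterLastA bAtZero : LTL (Var P)
lastA       = atˡ a ∧ˡ ¬ˡ Xˡ (atˡ a)
nextB       = Xˡ (atˡ b)
aIsSegment  = atˡ a Uˡ Gˡ (¬ˡ atˡ a)
bAfterLastA = Gˡ (lastA ⇔ˡ nextB)
bAtZero     = (¬ˡ atˡ a) ⇔ˡ atˡ b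

parameterSpec : LTL (Var P)
parameterSpec = aIsSegment ∧ˡ bAfterLastA ∧ˡ bAtZero

toLTL-encodes : (I : SInterp P) → EncodesParameter (toLTL I) (proj₂ I)
toLTL-encodes (σ , n) = (λ t → <ᵇ≡true⇔<) , (λ t → ≡ᵇ≡true⇔≡)

encodes⇒⊨parameterSpec : EncodesParameter τ n → τ ⊨ˡ parameterSpec
encodes⇒⊨parameterSpec {τ = τ} {n = n} (a⇔ , b⇔) =
    (n , never , λ i i<n → from (a⇔ i) i<n)
  , G-intro τ 0 (lastA ⇔ˡ nextB)
      (λ t → ⇔ˡ-intro {σ = τ} {t = t} {φ = lastA} {ψ = nextB} (lastA⇔nextB t))
  , ⇔ˡ-intro {σ = τ} {t = 0} {φ = ¬ˡ atˡ a} {ψ = atˡ b} ¬a⇔b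
  where
  never : τ ∣ n ⊨ˡ Gˡ (¬ˡ atˡ a)
  never = G-intro τ n (¬ˡ atˡ a) λ j an+j → m+n≮m n j (to (a⇔ (n + j)) an+j)

  lastA⇔nextB : ∀ t → (τ a t ≡ true × ¬ τ a (suc t) ≡ true) ⇔ τ b (suc t) ≡ true
  lastA⇔nextB t = begin
    (τ a t ≡ true × ¬ τ a (suc t) ≡ true) ∼⟨ a⇔ t ×-⇔ ¬-cong-⇔ (a⇔ (suc t)) ⟩
    (t < n × ¬ suc t < n)                 ∼⟨ m<n×1+m≮n⇔1+m≡n ⟩
    suc t ≡ n                             ∼⟨ ⇔-sym (b⇔ (suc t)) ⟩
    τ b (suc t) ≡ true                    ∎

  ¬a⇔b : (¬ τ a 0 ≡ true) ⇔ τ b 0 ≡ true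
  ¬a⇔b = begin
    (¬ τ a 0 ≡ true) ∼⟨ ¬-cong-⇔ (a⇔ 0) ⟩
    (¬ 0 < n)        ∼⟨ 0≮n⇔0≡n ⟩
    0 ≡ n            ∼⟨ ⇔-sym (b⇔ 0) ⟩
    τ b 0 ≡ true     ∎

b⇔≡-from-spec : (∀ t → τ a t ≡ true ⇔ t < n) → τ ⊨ˡ bAfterLastA → τ ⊨ˡ bAtZero →
                ∀ t → τ b t ≡ true ⇔ t ≡ n
b⇔≡-from-spec {τ = τ} {n = n} a⇔ bAfter bZero zero = begin
  τ b 0 ≡ true     ∼⟨ ⇔-sym (⇔ˡ-elim {σ = τ} {t = 0} (¬ˡ atˡ a) (atˡ b) bZero) ⟩
  (¬ τ a 0 ≡ true) ∼⟨ ¬-cong-⇔ (a⇔ 0) ⟩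
  (¬ 0 < n)        ∼⟨ 0≮n⇔0≡n ⟩
  0 ≡ n            ∎
b⇔≡-from-spec {τ = τ} {n = n} a⇔ bAfter bZero (suc t) = begin
  τ b (suc t) ≡ true                    ∼⟨ ⇔-sym lastA⇔nextB ⟩
  (τ a t ≡ true × ¬ τ a (suc t) ≡ true) ∼⟨ a⇔ t ×-⇔ ¬-cong-⇔ (a⇔ (suc t)) ⟩
  (t < n × ¬ suc t < n)                 ∼⟨ m<n×1+m≮n⇔1+m≡n ⟩
  suc t ≡ n                             ∎
  where
  lastAˡ : Local lastA
  lastAˡ = atˡ a ∧ˡ ¬ˡ Xˡ (atˡ a)

  nextBˡ : Local nextB
  nextBˡ = Xˡ (atˡ b)

  lastA⇔nextB : (τ ∣ t ⊨ˡ lastA) ⇔ (τ ∣ t ⊨ˡ nextB)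
  lastA⇔nextB =
    ⇔ˡ-elim {σ = τ} lastAˡ nextBˡ (G-elim {σ = τ} (⇔ˡ-local lastAˡ nextBˡ) bAfter t)

⊨parameterSpec⇒encodes : τ ⊨ˡ parameterSpec → Σ ℕ (EncodesParameter τ)
⊨parameterSpec⇒encodes {τ = τ} (segment , bAfter , bZero) =
  let (n , a⇔) = U-G¬-segment {σ = τ} {v = a} segment
  in n , (a⇔ , b⇔≡-from-spec {τ = τ} a⇔ bAfter bZero)

encodes⇒IsInitialSegment : EncodesParameter τ n → IsInitialSegment τ n
encodes⇒IsInitialSegment (a⇔ , _) t = to (a⇔ t) , from (a⇔ t)

encodes⇒toLTL≈ : EncodesParameter τ n → toLTL (restrict τ , n) ≈ᴵ τ
encodes⇒toLTL≈ enc       (var p) t = refl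
encodes⇒toLTL≈ (a⇔ , _)  a       t = ≡true⇔⇒≡ (⇔-trans <ᵇ≡true⇔< (⇔-sym (a⇔ t)))
encodes⇒toLTL≈ (_ , b⇔)  b       t = ≡true⇔⇒≡ (⇔-trans ≡ᵇ≡true⇔≡ (⇔-sym (b⇔ t)))

mainTheorem3 : {P : Set} (s : SPS P) →
    ((I : SInterp P) → I ⊨ˢ s → toLTL I ⊨ˡ ⌊ s ⌋)
    × ((I : SInterp P) → I ⊨ˢ s →
        Σ (IsInitialSegment (toLTL I) (proj₂ I)) λ h →
          fromLTL (toLTL I) (proj₂ I) h ≈ˢ I)
    × ((τ : Interp (Var P)) → τ ⊨ˡ ⌊ s ⌋ →
        Σ ℕ λ n → Σ (IsInitialSegment τ n) λ h →
          (fromLTL τ n h ⊨ˢ s) × (toLTL (fromLTL τ n h) ≈ᴵ τ))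
mainTheorem3 s =
    (λ I I⊨s → from (⌊⌋ᵖʳᵒᵖ-correct (toLTL-encodes I) s) I⊨s
             , encodes⇒⊨parameterSpec (toLTL-encodes I))
  , (λ I _ → encodes⇒IsInitialSegment (toLTL-encodes I) , refl , λ _ _ → refl)
  , λ τ (τ⊨s , τ⊨spec) →
      let (n , enc) = ⊨parameterSpec⇒encodes τ⊨spec
      in n , encodes⇒IsInitialSegment enc , to (⌊⌋ᵖʳᵒᵖ-correct enc s) τ⊨s , encodes⇒toLTL≈ enc
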